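{- Let $m,n\ge1$, let $G=G_{m\times n}$, let $d=\gcd(m+1,n+1)$ and let $v=(a,b)$ be a vertex of $G$. If $d\nmid a$ and $d\nmid b$, then $(G,v)$ is a P-position in the Undirected Edge Geography game.
   Context: $G_{m\times n}=P_m\square P_n$ is the grid graph with vertex set $[m]\times[n]$, $(i,j)\sim(i',j')$ iff $|i-i'|+|j-j'|=1$. Undirected Edge Geography is a two-player game on a rooted graph: a position is $(H,v)$ with $v$ the root; a move chooses an edge of $H$ incident to $v$, deletes it, and makes its other endpoint the new root; players alternate and the first player unable to move loses. A position is an N-position if the player to move has a winning strategy, and a P-position otherwise (the player to move loses under optimal play). -}

module Defs where

open import Data.Nat using (ℕ; _+_; _≤_; ∣_-_∣)
open import Data.Product using (_×_; _,_; Σ)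
open import Data.List using (List; []; _∷_)
open import Data.List.Membership.Propositional using (_∈_)
open import Data.Sum using (_⊎_)
open import Relation.Nullary using (¬_)
open import Relation.Binary.PropositionalEquality using (_≡_)

Vertex : Set
Vertex = ℕ × ℕ

InGrid : ℕ → ℕ → Vertex → Set
InGrid m n (i , j) = (1 ≤ i × i ≤ m) × (1 ≤ j × j ≤ n)

Adjacent : Vertex → Vertex → Set
Adjacent (i , j) (i' , j') = ∣ i - i' ∣ + ∣ j - j' ∣ ≡ 1

-- A list of deleted edges, each recorded as an (oriented) pair of endpoints;
-- the undirected edge {u,w} is deleted iff (u,w) or (w,u) is in the list.
Deleted : List (Vertex × Vertex) → Vertex → Vertex → Set
Deleted D u w = ((u , w) ∈ D) ⊎ ((w , u) ∈ D)

-- A position of Undirected Edge Geography on G_{m×n}: the graph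
-- H = G_{m×n} minus the deleted edges D, with root v.
record Position : Set where
  constructor pos
  field
    deleted : List (Vertex × Vertex)
    root    : Vertex

record Move (m n : ℕ) (p : Position) (w : Vertex) : Set where
  constructor move
  open Position p
  field
    target-in-grid : InGrid m n w
    adjacent       : Adjacent root w
    not-deleted    : ¬ Deleted deleted root w

after : Position → Vertex → Position
after (pos D v) w = pos ((v , w) ∷ D) w

-- N-positions (player to move wins) and P-positions (player to move loses),
-- defined inductively; the game is finite, so these are the usual notions.
mutual
  data NPos (m n : ℕ) (p : Position) : Set where
    win : (w : Vertex) → Move m n p w → PPos m n (after p w) → NPos m n p

  data PPos (m n : ℕ) (p : Position) : Set where
    lose : ((w : Vertex) → Move m n p w → NPos m n (after p w)) → PPos m n p

{-# OPTIONS --safe #-}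
-- The second player wins by a pairing strategy. Colour each vertex by the parity of x + y,
-- put M = 2d and c = a + b, and let S be the set of vertices of the colour of (a , b) lying on
-- exactly one of the lines x + y ≡ ±c and x − y ≡ ±c (mod M). Then
--   * (a , b) ∈ S, since d ∤ a and d ∤ b keep it off the lines x − y ≡ ±c;
--   * S avoids the frame x ∈ {0, m + 1}, y ∈ {0, n + 1}: as d divides m + 1 and n + 1, on the
--     frame x + y ≡ ±(x − y) (mod M), so a frame vertex lies on both families or on neither;
--   * every vertex of the other colour has an even number of neighbours in S, because its
--     four neighbours pair up on common lines.
-- Invariant: the root lies in S and every vertex of the other colour has an even number of
-- undeleted edges into S. The player to move leaves the root along such an edge to some w;
-- another undeleted edge leads from w into S, and answering along it restores the invariant.
-- Since every move deletes an edge, the player to move eventually loses.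

module Submission where

open import Defs
open import Data.Nat using (ℕ; _≤_)
open import Data.Nat.GCD using (gcd)
open import Data.Nat.Divisibility using (_∣_)
open import Data.Nat.Base using (_+_)
open import Data.List using ([])
open import Data.Product using (_,_)
open import Relation.Nullary using (¬_)

open import Data.Bool.Base using (Bool; true; false; not; _∧_; _xor_)
open import Data.Bool.Properties
  using (not-involutive; not-distribˡ-xor; not-distribʳ-xor; not-¬; xor-same; ∧-zeroʳ; ∧-identityʳ)
open import Data.Fin.Base using (Fin; zero; suc)
import Data.Fin.Properties as Fin
open import Data.Integer.Base as ℤ using (ℤ; +_; -_; _⊖_; 0ℤ)
import Data.Integer.Divisibility.Signed as ℤ
import Data.Integer.Properties as ℤ
open import Data.Integer.Tactic.RingSolver using (solve-∀)
open import Data.List.Base using (List; _∷_; filter; length; cartesianProduct; upTo)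
open import Data.List.Membership.Propositional using (_∈_)
open import Data.List.Membership.Propositional.Properties using (∈-cartesianProduct⁺; ∈-upTo⁺)
open import Data.List.Relation.Unary.Any using (here; there)
open import Data.Nat.Base using (zero; suc; _<_; _*_; z≤n; s≤s; ∣_-_∣; parity)
open import Data.Nat.Divisibility using (*-monoʳ-∣; *-cancelˡ-∣)
open import Data.Nat.GCD using (gcd[m,n]∣m; gcd[m,n]∣n)
open import Data.Nat.Induction using (<-wellFounded)
open import Data.Nat.Properties
  using (_≟_; +-suc; +-identityʳ; +-comm; +-cancelʳ-≡; ∣n-n∣≡0; ∣m-n∣≡0⇒m≡n; ∣-∣-comm;
         m≤n⇒m≤1+n; m<n⇒m<1+n; <⇒≤; m≤n⇒m<n∨m≡n)
open import Data.Parity.Base using (Parity; 0ℙ; 1ℙ; _⁻¹)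
import Data.Parity.Properties as ℙ
open import Data.Product using (_×_; ∃; proj₁; proj₂)
import Data.Product as Product
open import Data.Product.Properties using (≡-dec; ×-≡,≡→≡)
open import Data.Sum using (_⊎_; inj₁; inj₂)
import Data.Sum as Sum
open import Data.Vec.Functional using (updateAt)
open import Data.Vec.Functional.Properties using (updateAt-updates; updateAt-minimal)
open import Function.Base using (_∘_)
open import Function.Bundles using (_⇔_; mk⇔; Equivalence)
open import Induction.WellFounded using (Acc; acc)
open import Relation.Binary.Definitions using (DecidableEquality)
open import Relation.Binary.PropositionalEquality
  using (_≡_; _≢_; _≗_; refl; sym; trans; cong; cong₂; subst; module ≡-Reasoning)
open import Relation.Nullary using (Dec; yes; no; does; contradiction)
open import Relation.Nullary.Decidable using (_⊎-dec_; map′; dec-true; dec-false; does-⇔)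
open import Relation.Unary using (Decidable; _⊆_)

open ≡-Reasoning

-- Booleans and parity

does≡true⇒ : ∀ {A : Set} (a? : Dec A) → does a? ≡ true → A
does≡true⇒ (yes a) _ = a

not-does≡true⇒¬ : ∀ {A : Set} (a? : Dec A) → not (does a?) ≡ true → ¬ A
not-does≡true⇒¬ (no ¬a) _ = ¬a

∧-≡-true : ∀ {x y} → x ∧ y ≡ true → x ≡ true × y ≡ true
∧-≡-true {true} {true} _ = refl , refl

oddCount : ∀ {k} → (Fin k → Bool) → Bool
oddCount {zero}  f = false
oddCount {suc k} f = f zero xor oddCount (f ∘ suc)

oddCount-cong : ∀ {k} {f g : Fin k → Bool} → f ≗ g → oddCount f ≡ oddCount g
oddCount-cong {zero}  f≗g = refl
oddCount-cong {suc k} f≗g = cong₂ _xor_ (f≗g zero) (oddCount-cong (f≗g ∘ suc))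

oddCount-updateAt-not : ∀ {k} (f : Fin k → Bool) i → oddCount (updateAt f i not) ≡ not (oddCount f)
oddCount-updateAt-not f zero    = sym (not-distribˡ-xor (f zero) _)
oddCount-updateAt-not f (suc i) = begin
  f zero xor oddCount (updateAt (f ∘ suc) i not)
    ≡⟨ cong (f zero xor_) (oddCount-updateAt-not (f ∘ suc) i) ⟩
  f zero xor not (oddCount (f ∘ suc))
    ≡⟨ not-distribʳ-xor (f zero) _ ⟨
  not (oddCount f)
    ∎

oddCount≡true⇒∃ : ∀ {k} (f : Fin k → Bool) → oddCount f ≡ true → ∃ λ i → f i ≡ true
oddCount≡true⇒∃ {suc k} f odd with f zero in f₀
... | true  = zero , f₀
... | false = let i , fi = oddCount≡true⇒∃ (f ∘ suc) odd in suc i , fi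

oddCount≡false⇒∃≢ : ∀ {k} (f : Fin k → Bool) {i} → oddCount f ≡ false → f i ≡ true →
                    ∃ λ j → j ≢ i × f j ≡ true
oddCount≡false⇒∃≢ f {i} even fi
  with j , flipped-j ← oddCount≡true⇒∃ (updateAt f i not)
                         (trans (oddCount-updateAt-not f i) (cong not even))
  with j Fin.≟ i
... | yes refl = contradiction (trans (sym flipped-j) (trans (updateAt-updates i f) (cong not fi))) λ ()
... | no j≢i   = j , j≢i , trans (sym (updateAt-minimal j i f j≢i)) flipped-j

oddCount-clear₂ : ∀ {k} {f g : Fin k → Bool} {i j} → i ≢ j →
                  f i ≡ true → f j ≡ true → g i ≡ false → g j ≡ false →
                  (∀ l → l ≢ i → l ≢ j → g l ≡ f l) → oddCount g ≡ oddCount f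
oddCount-clear₂ {f = f} {g} {i} {j} i≢j fi fj gi gj others = begin
  oddCount g                       ≡⟨ oddCount-cong g≗flipped ⟩
  oddCount (updateAt fᵢ j not)     ≡⟨ oddCount-updateAt-not fᵢ j ⟩
  not (oddCount fᵢ)                ≡⟨ cong not (oddCount-updateAt-not f i) ⟩
  not (not (oddCount f))           ≡⟨ not-involutive _ ⟩
  oddCount f                       ∎
  where
  fᵢ : Fin _ → Bool
  fᵢ = updateAt f i not
  g≗flipped : g ≗ updateAt fᵢ j not
  g≗flipped l with l Fin.≟ j | l Fin.≟ i
  ... | yes refl | _ = sym (begin
    updateAt fᵢ l not l ≡⟨ updateAt-updates l fᵢ ⟩
    not (fᵢ l)          ≡⟨ cong not (updateAt-minimal l i f (i≢j ∘ sym)) ⟩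
    not (f l)           ≡⟨ cong not fj ⟩
    false               ≡⟨ gj ⟨
    g l                 ∎)
  ... | no l≢j | yes refl = sym (begin
    updateAt fᵢ j not l ≡⟨ updateAt-minimal l j fᵢ l≢j ⟩
    updateAt f l not l  ≡⟨ updateAt-updates l f ⟩
    not (f l)           ≡⟨ cong not fi ⟩
    false               ≡⟨ gi ⟨
    g l                 ∎)
  ... | no l≢j | no l≢i = trans (others l l≢i l≢j)
    (sym (trans (updateAt-minimal l j fᵢ l≢j) (updateAt-minimal l i f l≢i)))

-- Deleted edges

module _ {A : Set} {P Q : A → Set} (P? : Decidable P) (Q? : Decidable Q) (P⊆Q : P ⊆ Q) where

  length-filter-mono : ∀ xs → length (filter P? xs) ≤ length (filter Q? xs)
  length-filter-mono []       = z≤n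
  length-filter-mono (x ∷ xs) with P? x | Q? x
  ... | yes _  | yes _  = s≤s (length-filter-mono xs)
  ... | yes px | no ¬qx = contradiction (P⊆Q px) ¬qx
  ... | no _   | yes _  = m≤n⇒m≤1+n (length-filter-mono xs)
  ... | no _   | no _   = length-filter-mono xs

  length-filter-< : ∀ {x xs} → x ∈ xs → Q x → ¬ P x → length (filter P? xs) < length (filter Q? xs)
  length-filter-< {x} {_ ∷ xs} (here refl) qx ¬px with P? x | Q? x
  ... | yes px | _      = contradiction px ¬px
  ... | no _   | yes _  = s≤s (length-filter-mono xs)
  ... | no _   | no ¬qx = contradiction qx ¬qx
  length-filter-< {xs = y ∷ xs} (there x∈xs) qx ¬px with P? y | Q? y
  ... | yes _  | yes _  = s≤s (length-filter-< x∈xs qx ¬px)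
  ... | yes py | no ¬qy = contradiction (P⊆Q py) ¬qy
  ... | no _   | yes _  = m<n⇒m<1+n (length-filter-< x∈xs qx ¬px)
  ... | no _   | no _   = length-filter-< x∈xs qx ¬px

Edge : Set
Edge = Vertex × Vertex

_≟ᵛ_ : DecidableEquality Vertex
_≟ᵛ_ = ≡-dec _≟_ _≟_

_≟ᵉ_ : DecidableEquality Edge
_≟ᵉ_ = ≡-dec _≟ᵛ_ _≟ᵛ_

open import Data.List.Membership.DecPropositional _≟ᵉ_ using (_∈?_; _∉?_)

deleted? : ∀ D u v → Dec (Deleted D u v)
deleted? D u v = ((u , v) ∈? D) ⊎-dec ((v , u) ∈? D)

Deleted-sym : ∀ {D u v} → Deleted D u v → Deleted D v u
Deleted-sym = Sum.swap

Deleted-∷⁺ : ∀ {D e u v} → Deleted D u v → Deleted (e ∷ D) u v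
Deleted-∷⁺ = Sum.map there there

Deleted-∷⁻ : ∀ {D p q u v} → u ≢ p → u ≢ q → Deleted ((p , q) ∷ D) u v → Deleted D u v
Deleted-∷⁻ u≢p u≢q (inj₁ (here refl)) = contradiction refl u≢p
Deleted-∷⁻ u≢p u≢q (inj₁ (there uv∈D)) = inj₁ uv∈D
Deleted-∷⁻ u≢p u≢q (inj₂ (here refl)) = contradiction refl u≢q
Deleted-∷⁻ u≢p u≢q (inj₂ (there vu∈D)) = inj₂ vu∈D

-- Grid geometry

Dir : Set
Dir = Fin 4

pattern west  = zero
pattern east  = suc zero
pattern north = suc (suc zero)
pattern south = suc (suc (suc zero))

offset : Dir → ℕ × ℕ
offset west  = 0 , 1
offset east  = 2 , 1
offset north = 1 , 0
offset south = 1 , 2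

-- neighbour i a b is the neighbour of (1 + a , 1 + b) in direction i.
neighbour : Dir → ℕ → ℕ → Vertex
neighbour i a b = proj₁ (offset i) + a , proj₂ (offset i) + b

direction : ℕ × ℕ → Dir
direction (0 , _) = west
direction (2 , _) = east
direction (_ , 0) = north
direction _       = south

direction-offset : ∀ i → direction (offset i) ≡ i
direction-offset west  = refl
direction-offset east  = refl
direction-offset north = refl
direction-offset south = refl

neighbour-injective : ∀ {i j a b} → neighbour i a b ≡ neighbour j a b → i ≡ j
neighbour-injective {i} {j} {a} {b} eq = begin
  i                    ≡⟨ direction-offset i ⟨
  direction (offset i) ≡⟨ cong direction offset-i≡offset-j ⟩
  direction (offset j) ≡⟨ direction-offset j ⟩
  j                    ∎
  where
  offset-i≡offset-j : offset i ≡ offset j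
  offset-i≡offset-j =
    ×-≡,≡→≡ (+-cancelʳ-≡ a _ _ (cong proj₁ eq) , +-cancelʳ-≡ b _ _ (cong proj₂ eq))

∣n-1+n∣≡1 : ∀ n → ∣ n - suc n ∣ ≡ 1
∣n-1+n∣≡1 zero    = refl
∣n-1+n∣≡1 (suc n) = ∣n-1+n∣≡1 n

∣1+n-n∣≡1 : ∀ n → ∣ suc n - n ∣ ≡ 1
∣1+n-n∣≡1 n = trans (∣-∣-comm (suc n) n) (∣n-1+n∣≡1 n)

m+n≡1⇒ : ∀ {m n} → m + n ≡ 1 → (m ≡ 0 × n ≡ 1) ⊎ (m ≡ 1 × n ≡ 0)
m+n≡1⇒ {zero}           eq = inj₁ (refl , eq)
m+n≡1⇒ {suc zero} {zero} _ = inj₂ (refl , refl)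

∣m-n∣≡1⇒ : ∀ {m n} → ∣ m - n ∣ ≡ 1 → m ≡ suc n ⊎ n ≡ suc m
∣m-n∣≡1⇒ {zero}     {suc zero} _ = inj₂ refl
∣m-n∣≡1⇒ {suc zero} {zero}     _ = inj₁ refl
∣m-n∣≡1⇒ {suc m}    {suc n}   eq = Sum.map (cong suc) (cong suc) (∣m-n∣≡1⇒ eq)

neighbour-adjacent : ∀ i a b → Adjacent (suc a , suc b) (neighbour i a b)
neighbour-adjacent west  a b = cong₂ _+_ (∣1+n-n∣≡1 a) (∣n-n∣≡0 b)
neighbour-adjacent east  a b = cong₂ _+_ (∣n-1+n∣≡1 a) (∣n-n∣≡0 b)
neighbour-adjacent north a b = cong₂ _+_ (∣n-n∣≡0 a) (∣1+n-n∣≡1 b)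
neighbour-adjacent south a b = cong₂ _+_ (∣n-n∣≡0 a) (∣n-1+n∣≡1 b)

adjacent⇒neighbour : ∀ {r a b} → Adjacent r (suc a , suc b) → ∃ λ i → neighbour i a b ≡ r
adjacent⇒neighbour {x , y} {a} {b} adj with m+n≡1⇒ {∣ x - suc a ∣} {∣ y - suc b ∣} adj
... | inj₁ (dx≡0 , dy≡1) with ∣m-n∣≡0⇒m≡n {x} dx≡0 | ∣m-n∣≡1⇒ {y} dy≡1
...   | refl | inj₁ refl = south , refl
...   | refl | inj₂ refl = north , refl
adjacent⇒neighbour {x , y} {a} {b} adj | inj₂ (dx≡1 , dy≡0)
  with ∣m-n∣≡1⇒ {x} dx≡1 | ∣m-n∣≡0⇒m≡n {y} dy≡0
...   | inj₁ refl | refl = east , refl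
...   | inj₂ refl | refl = west , refl

adjacent-irrefl : ∀ v → ¬ Adjacent v v
adjacent-irrefl (x , y) adj =
  contradiction (trans (sym (cong₂ _+_ (∣n-n∣≡0 x) (∣n-n∣≡0 y))) adj) λ ()

neighbour-≢ : ∀ i {a b} → neighbour i a b ≢ (suc a , suc b)
neighbour-≢ i {a} {b} eq =
  adjacent-irrefl (suc a , suc b) (subst (Adjacent (suc a , suc b)) eq (neighbour-adjacent i a b))

colour : Vertex → Parity
colour (x , y) = parity (x + y)

parity-suc : ∀ n → parity (suc n) ≡ parity n ⁻¹
parity-suc n = sym (ℙ.⁻¹-selfInverse (ℙ.suc-homo-⁻¹ n))

colour-neighbour : ∀ i a b → colour (neighbour i a b) ≡ colour (suc a , suc b) ⁻¹
colour-neighbour west  a b = sym (ℙ.suc-homo-⁻¹ (a + suc b))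
colour-neighbour east  a b = sym (ℙ.suc-homo-⁻¹ (a + suc b))
colour-neighbour north a b rewrite +-suc a b = parity-suc (a + b)
colour-neighbour south a b rewrite +-suc a (suc b) = sym (ℙ.suc-homo-⁻¹ (a + suc b))

≢⇒⁻¹≡ : ∀ {p q : Parity} → p ≢ q → p ⁻¹ ≡ q
≢⇒⁻¹≡ {0ℙ} {0ℙ} p≢q = contradiction refl p≢q
≢⇒⁻¹≡ {0ℙ} {1ℙ} _   = refl
≢⇒⁻¹≡ {1ℙ} {0ℙ} _   = refl
≢⇒⁻¹≡ {1ℙ} {1ℙ} p≢q = contradiction refl p≢q

xor-pairs : ∀ p q r s → (p xor q) xor ((r xor s) xor ((p xor s) xor ((r xor q) xor false))) ≡ false
xor-pairs false false false false = refl
xor-pairs false false false true  = refl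
xor-pairs false false true  false = refl
xor-pairs false false true  true  = refl
xor-pairs false true  false false = refl
xor-pairs false true  false true  = refl
xor-pairs false true  true  false = refl
xor-pairs false true  true  true  = refl
xor-pairs true  false false false = refl
xor-pairs true  false false true  = refl
xor-pairs true  false true  false = refl
xor-pairs true  false true  true  = refl
xor-pairs true  true  false false = refl
xor-pairs true  true  false true  = refl
xor-pairs true  true  true  false = refl
xor-pairs true  true  true  true  = refl

oddCount-pairs : ∀ (A D : Dir → Bool) → A north ≡ A west → A south ≡ A east →
                 D north ≡ D east → D south ≡ D west → oddCount (λ i → A i xor D i) ≡ false
oddCount-pairs A D An≡Aw As≡Ae Dn≡De Ds≡Dw rewrite An≡Aw | As≡Ae | Dn≡De | Ds≡Dw =
  xor-pairs (A west) (D west) (A east) (D east)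

-- The pairing strategy

module PairingStrategy
  (m n : ℕ) (κ : Parity) (S : Vertex → Bool)
  (S-colour : ∀ v → S v ≡ true → colour v ≡ κ)
  (S-inside : ∀ {a b} i → InGrid m n (suc a , suc b) → S (neighbour i a b) ≡ true →
              InGrid m n (neighbour i a b))
  (S-even : ∀ a b → InGrid m n (suc a , suc b) → colour (suc a , suc b) ≢ κ →
            oddCount (λ i → S (neighbour i a b)) ≡ false)
  where

  gridVertices : List Vertex
  gridVertices = cartesianProduct (upTo (suc m)) (upTo (suc n))

  ∈-gridVertices : ∀ {v} → InGrid m n v → v ∈ gridVertices
  ∈-gridVertices ((_ , x≤m) , (_ , y≤n)) =
    ∈-cartesianProduct⁺ (∈-upTo⁺ (s≤s x≤m)) (∈-upTo⁺ (s≤s y≤n))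

  undeleted : List Edge → ℕ
  undeleted D = length (filter (_∉? D) (cartesianProduct gridVertices gridVertices))

  -- Opaque, so that the implicit arguments of the lemmas about live can be inferred.
  opaque
    live : List Edge → ℕ → ℕ → Dir → Bool
    live D a b i = S (neighbour i a b) ∧ not (does (deleted? D (neighbour i a b) (suc a , suc b)))

  opaque
    unfolding live

    live≡true⁺ : ∀ {D a b i} → S (neighbour i a b) ≡ true →
                 ¬ Deleted D (neighbour i a b) (suc a , suc b) → live D a b i ≡ true
    live≡true⁺ {D} s ¬del = cong₂ (λ s d → s ∧ not d) s (dec-false (deleted? D _ _) ¬del)

    live≡true⁻ : ∀ {D a b i} → live D a b i ≡ true →
                 S (neighbour i a b) ≡ true × ¬ Deleted D (neighbour i a b) (suc a , suc b)
    live≡true⁻ {D} eq = Product.map₂ (not-does≡true⇒¬ (deleted? D _ _)) (∧-≡-true eq)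

    live≡false : ∀ {D a b i} → Deleted D (neighbour i a b) (suc a , suc b) → live D a b i ≡ false
    live≡false {D} {a} {b} {i} del =
      trans (cong (λ d → S (neighbour i a b) ∧ not d) (dec-true (deleted? D _ _) del)) (∧-zeroʳ _)

    live-[] : ∀ {a b} → live [] a b ≗ λ i → S (neighbour i a b)
    live-[] {a} {b} i = trans
      (cong (λ d → S (neighbour i a b) ∧ not d)
            (dec-false (deleted? [] (neighbour i a b) (suc a , suc b)) Sum.[ (λ ()) , (λ ()) ]))
      (∧-identityʳ _)

    live-⇔ : ∀ {D D′ a b i} →
             Deleted D′ (neighbour i a b) (suc a , suc b) ⇔ Deleted D (neighbour i a b) (suc a , suc b) →
             live D′ a b i ≡ live D a b i
    live-⇔ {D} {D′} {a} {b} {i} eqv =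
      cong (λ d → S (neighbour i a b) ∧ not d) (does-⇔ eqv (deleted? D′ _ _) (deleted? D _ _))

  live-∷ˡ : ∀ {D p q a b i} → neighbour i a b ≢ p → neighbour i a b ≢ q →
            live ((p , q) ∷ D) a b i ≡ live D a b i
  live-∷ˡ u≢p u≢q = live-⇔ (mk⇔ (Deleted-∷⁻ u≢p u≢q) Deleted-∷⁺)

  live-∷ʳ : ∀ {D p q a b} → (suc a , suc b) ≢ p → (suc a , suc b) ≢ q →
            live ((p , q) ∷ D) a b ≗ live D a b
  live-∷ʳ w≢p w≢q _ =
    live-⇔ (mk⇔ (Deleted-sym ∘ Deleted-∷⁻ w≢p w≢q ∘ Deleted-sym) Deleted-∷⁺)

  record Invariant (D : List Edge) (r : Vertex) : Set where
    field
      root-in-grid : InGrid m n r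
      root-in-S    : S r ≡ true
      live-even    : ∀ {a b} → InGrid m n (suc a , suc b) → colour (suc a , suc b) ≢ κ →
                     oddCount (live D a b) ≡ false

  module Reply {D r a b} (inv : Invariant D r) (mv : Move m n (pos D r) (suc a , suc b)) where
    open Invariant inv
    open Move mv

    w : Vertex
    w = suc a , suc b

    back : Dir
    back = proj₁ (adjacent⇒neighbour {r} {a} {b} adjacent)

    back-root : neighbour back a b ≡ r
    back-root = proj₂ (adjacent⇒neighbour {r} {a} {b} adjacent)

    w-white : colour w ≢ κ
    w-white w≡κ = ℙ.p≢p⁻¹ κ (begin
      κ                           ≡⟨ S-colour r root-in-S ⟨
      colour r                    ≡⟨ cong colour back-root ⟨
      colour (neighbour back a b) ≡⟨ colour-neighbour back a b ⟩
      colour w ⁻¹                 ≡⟨ cong _⁻¹ w≡κ ⟩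
      κ ⁻¹                        ∎)

    back-live : live D a b back ≡ true
    back-live = live≡true⁺ (subst (λ v → S v ≡ true) (sym back-root) root-in-S)
                           (not-deleted ∘ subst (λ v → Deleted D v w) back-root)

    answer : ∃ λ i → i ≢ back × live D a b i ≡ true
    answer = oddCount≡false⇒∃≢ (live D a b) (live-even target-in-grid w-white) back-live

    out : Dir
    out = proj₁ answer

    out≢back : out ≢ back
    out≢back = proj₁ (proj₂ answer)

    out-live : live D a b out ≡ true
    out-live = proj₂ (proj₂ answer)

    y : Vertex
    y = neighbour out a b

    y-in-S : S y ≡ true
    y-in-S = proj₁ (live≡true⁻ out-live)

    y-undeleted : ¬ Deleted D y w
    y-undeleted = proj₂ (live≡true⁻ out-live)

    neighbour≢r : ∀ {i} → i ≢ back → neighbour i a b ≢ r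
    neighbour≢r i≢back eq = i≢back (neighbour-injective (trans eq (sym back-root)))

    legal : Move m n (after (pos D r) w) y
    legal = move (S-inside out target-in-grid y-in-S) (neighbour-adjacent out a b)
                 (y-undeleted ∘ Deleted-∷⁻ (neighbour≢r out≢back) (neighbour-≢ out) ∘ Deleted-sym)

    D′ : List Edge
    D′ = (w , y) ∷ (r , w) ∷ D

    live-even-at-w : oddCount (live D′ a b) ≡ false
    live-even-at-w = trans
      (oddCount-clear₂ {f = live D a b} {g = live D′ a b} (out≢back ∘ sym) back-live out-live
        (live≡false (inj₁ (there (here (cong (_, w) back-root)))))
        (live≡false (inj₂ (here refl)))
        (λ l l≢back l≢out → trans (live-∷ˡ (neighbour-≢ l) (l≢out ∘ neighbour-injective))
                                  (live-∷ˡ (neighbour≢r l≢back) (neighbour-≢ l))))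
      (live-even target-in-grid w-white)

    live-even-elsewhere : ∀ {a′ b′} → InGrid m n (suc a′ , suc b′) →
                          colour (suc a′ , suc b′) ≢ κ → (suc a′ , suc b′) ≢ w →
                          oddCount (live D′ a′ b′) ≡ false
    live-even-elsewhere {a′} {b′} g white w′≢w = trans
      (oddCount-cong {f = live D′ a′ b′} λ l →
        trans (live-∷ʳ w′≢w w′≢y l) (live-∷ʳ w′≢r w′≢w l))
      (live-even g white)
      where
      w′≢r : (suc a′ , suc b′) ≢ r
      w′≢r eq = white (trans (cong colour eq) (S-colour r root-in-S))
      w′≢y : (suc a′ , suc b′) ≢ y
      w′≢y eq = white (trans (cong colour eq) (S-colour y y-in-S))

    live-even-D′ : ∀ {a′ b′} → Dec ((suc a′ , suc b′) ≡ w) → InGrid m n (suc a′ , suc b′) →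
                 colour (suc a′ , suc b′) ≢ κ → oddCount (live D′ a′ b′) ≡ false
    live-even-D′ (yes refl) _ _     = live-even-at-w
    live-even-D′ (no w′≢w)  g white = live-even-elsewhere g white w′≢w

    invariant : Invariant D′ y
    invariant = record
      { root-in-grid = S-inside out target-in-grid y-in-S
      ; root-in-S    = y-in-S
      ; live-even    = λ g white → live-even-D′ (_ ≟ᵛ w) g white
      }

    decreasing : undeleted D′ < undeleted D
    decreasing = length-filter-< (_∉? D′) (_∉? D) (λ rw∉D′ → rw∉D′ ∘ there ∘ there)
      (∈-cartesianProduct⁺ (∈-gridVertices root-in-grid) (∈-gridVertices target-in-grid))
      (not-deleted ∘ inj₁) (λ rw∉D′ → rw∉D′ (there (here refl)))

  strategy : ∀ {D r} → Acc _<_ (undeleted D) → Invariant D r → PPos m n (pos D r)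
  strategy {D} {r} (acc smaller) inv = lose reply
    where
    reply : ∀ w → Move m n (pos D r) w → NPos m n (after (pos D r) w)
    reply (zero , _)      (move ((() , _) , _) _ _)
    reply (suc a , zero)  (move (_ , (() , _)) _ _)
    reply (suc a , suc b) mv = win y legal (strategy (smaller decreasing) invariant)
      where open Reply inv mv

  S-is-losing : ∀ {r} → InGrid m n r → S r ≡ true → PPos m n (pos [] r)
  S-is-losing r∈G r∈S = strategy (<-wellFounded _) record
    { root-in-grid = r∈G
    ; root-in-S    = r∈S
    ; live-even    = λ {a} {b} g white → trans (oddCount-cong live-[]) (S-even a b g white)
    }

-- Lines modulo M

module Congruence (M : ℤ) where

  infix 4 _≈_ _≈±_ _≈?_ _≈±?_

  record _≈_ (i j : ℤ) : Set where
    constructor modM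
    field
      M∣i-j : M ℤ.∣ i ℤ.- j

  _≈±_ : ℤ → ℤ → Set
  i ≈± j = i ≈ j ⊎ i ≈ - j

  _≈?_ : ∀ i j → Dec (i ≈ j)
  i ≈? j = map′ modM _≈_.M∣i-j (M ℤ.∣? i ℤ.- j)

  _≈±?_ : ∀ i j → Dec (i ≈± j)
  i ≈±? j = (i ≈? j) ⊎-dec (i ≈? - j)

  private
    minus-neg : ∀ i j → - (i ℤ.- j) ≡ j ℤ.- i
    minus-neg = solve-∀

    minus-trans : ∀ i j k → (i ℤ.- j) ℤ.+ (j ℤ.- k) ≡ i ℤ.- k
    minus-trans = solve-∀

    minus-neg-neg : ∀ i j → - (i ℤ.- j) ≡ - i ℤ.- - j
    minus-neg-neg = solve-∀

  ≈-reflexive : ∀ {i j} → i ≡ j → i ≈ j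
  ≈-reflexive {i} refl = modM (ℤ.divides 0ℤ (trans (ℤ.+-inverseʳ i) (sym (ℤ.*-zeroˡ M))))

  ≈-sym : ∀ {i j} → i ≈ j → j ≈ i
  ≈-sym {i} {j} (modM M∣i-j) = modM (subst (M ℤ.∣_) (minus-neg i j) (ℤ.∣m⇒∣-m M∣i-j))

  ≈-trans : ∀ {i j k} → i ≈ j → j ≈ k → i ≈ k
  ≈-trans {i} {j} {k} (modM M∣i-j) (modM M∣j-k) =
    modM (subst (M ℤ.∣_) (minus-trans i j k) (ℤ.∣m∣n⇒∣m+n M∣i-j M∣j-k))

  ≈-neg : ∀ {i j} → i ≈ j → - i ≈ - j
  ≈-neg {i} {j} (modM M∣i-j) = modM (subst (M ℤ.∣_) (minus-neg-neg i j) (ℤ.∣m⇒∣-m M∣i-j))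

  ≈±-respˡ : ∀ {i j k} → i ≈ j → i ≈± k → j ≈± k
  ≈±-respˡ i≈j = Sum.map (≈-trans (≈-sym i≈j)) (≈-trans (≈-sym i≈j))

  ≈±-neg : ∀ {i k} → i ≈± k → - i ≈± k
  ≈±-neg         (inj₁ i≈k)  = inj₂ (≈-neg i≈k)
  ≈±-neg {k = k} (inj₂ i≈-k) = inj₁ (subst (_ ≈_) (ℤ.neg-involutive k) (≈-neg i≈-k))

  ≈±-neg⁻ : ∀ {i k} → - i ≈± k → i ≈± k
  ≈±-neg⁻ {i} = subst (_≈± _) (ℤ.neg-involutive i) ∘ ≈±-neg

  ≈±-⇔ : ∀ {i j k} → i ≈± j → (i ≈± k ⇔ j ≈± k)
  ≈±-⇔ (inj₁ i≈j)  = mk⇔ (≈±-respˡ i≈j) (≈±-respˡ (≈-sym i≈j))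
  ≈±-⇔ (inj₂ i≈-j) =
    mk⇔ (≈±-neg⁻ ∘ ≈±-respˡ i≈-j) (≈±-respˡ (≈-sym i≈-j) ∘ ≈±-neg)

module Lines (M : ℤ) (κ : Parity) (c : ℤ) where
  open Congruence M

  antidiagonal : Vertex → ℤ
  antidiagonal (x , y) = + (x + y)

  diagonal : Vertex → ℤ
  diagonal (x , y) = x ⊖ y

  onLine : ℤ → Bool
  onLine t = does (t ≈±? c)

  S : Vertex → Bool
  S v = does (colour v ℙ.≟ κ) ∧ (onLine (antidiagonal v) xor onLine (diagonal v))

  private
    sum+diff : ∀ i j → (i ℤ.+ j) ℤ.- - (i ℤ.- j) ≡ i ℤ.+ i
    sum+diff = solve-∀

    sum-diff : ∀ i j → (i ℤ.+ j) ℤ.- (i ℤ.- j) ≡ j ℤ.+ j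
    sum-diff = solve-∀

    diff-sum : ∀ i j → - ((i ℤ.- j) ℤ.- (i ℤ.+ j)) ≡ j ℤ.+ j
    diff-sum = solve-∀

    diff+sum : ∀ i j → (i ℤ.- j) ℤ.- - (i ℤ.+ j) ≡ i ℤ.+ i
    diff+sum = solve-∀

  antidiagonal-ℤ : ∀ x y → antidiagonal (x , y) ≡ + x ℤ.+ + y
  antidiagonal-ℤ = ℤ.pos-+

  diagonal-ℤ : ∀ x y → diagonal (x , y) ≡ + x ℤ.- + y
  diagonal-ℤ x y = sym (ℤ.m-n≡m⊖n x y)

  ∣⇒≈ : ∀ {i j k} → M ℤ.∣ k → i ℤ.- j ≡ k → i ≈ j
  ∣⇒≈ M∣k eq = modM (subst (M ℤ.∣_) (sym eq) M∣k)

  S-colour : ∀ v → S v ≡ true → colour v ≡ κ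
  S-colour v = does≡true⇒ (colour v ℙ.≟ κ) ∘ proj₁ ∘ ∧-≡-true

  S-frame : ∀ v → antidiagonal v ≈± diagonal v → S v ≡ false
  S-frame v σ≈±δ = begin
    does (colour v ℙ.≟ κ) ∧ (onLine (antidiagonal v) xor onLine (diagonal v))
      ≡⟨ cong (λ t → does (colour v ℙ.≟ κ) ∧ (t xor onLine (diagonal v))) same-side ⟩
    does (colour v ℙ.≟ κ) ∧ (onLine (diagonal v) xor onLine (diagonal v))
      ≡⟨ cong (does (colour v ℙ.≟ κ) ∧_) (xor-same (onLine (diagonal v))) ⟩
    does (colour v ℙ.≟ κ) ∧ false
      ≡⟨ ∧-zeroʳ _ ⟩
    false
      ∎
    where
    same-side : onLine (antidiagonal v) ≡ onLine (diagonal v)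
    same-side = does-⇔ (≈±-⇔ σ≈±δ) (antidiagonal v ≈±? c) (diagonal v ≈±? c)

  frame-left : ∀ y → antidiagonal (0 , y) ≈± diagonal (0 , y)
  frame-left y = inj₂ (≈-reflexive (sym (trans (cong -_ (ℤ.⊖-swap 0 y)) (ℤ.neg-involutive (+ y)))))

  frame-top : ∀ x → antidiagonal (x , 0) ≈± diagonal (x , 0)
  frame-top x = inj₁ (≈-reflexive (cong +_ (+-identityʳ x)))

  frame-right : ∀ K y → M ℤ.∣ + K ℤ.+ + K → antidiagonal (K , y) ≈± diagonal (K , y)
  frame-right K y M∣2K = inj₂ (∣⇒≈ M∣2K (begin
    antidiagonal (K , y) ℤ.- - diagonal (K , y)
      ≡⟨ cong₂ (λ σ δ → σ ℤ.- - δ) (antidiagonal-ℤ K y) (diagonal-ℤ K y) ⟩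
    (+ K ℤ.+ + y) ℤ.- - (+ K ℤ.- + y)
      ≡⟨ sum+diff (+ K) (+ y) ⟩
    + K ℤ.+ + K
      ∎))

  frame-bottom : ∀ x L → M ℤ.∣ + L ℤ.+ + L → antidiagonal (x , L) ≈± diagonal (x , L)
  frame-bottom x L M∣2L = inj₁ (∣⇒≈ M∣2L (begin
    antidiagonal (x , L) ℤ.- diagonal (x , L)
      ≡⟨ cong₂ ℤ._-_ (antidiagonal-ℤ x L) (diagonal-ℤ x L) ⟩
    (+ x ℤ.+ + L) ℤ.- (+ x ℤ.- + L)
      ≡⟨ sum-diff (+ x) (+ L) ⟩
    + L ℤ.+ + L
      ∎))

  S-inside : ∀ {m n} → M ℤ.∣ + suc m ℤ.+ + suc m → M ℤ.∣ + suc n ℤ.+ + suc n →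
             ∀ {a b} i → InGrid m n (suc a , suc b) → S (neighbour i a b) ≡ true →
             InGrid m n (neighbour i a b)
  S-inside _ _ {zero} {b} west _ s =
    contradiction s (not-¬ (S-frame (0 , suc b) (frame-left (suc b))))
  S-inside _ _ {suc a} west ((_ , 2+a≤m) , b∈) _ = (s≤s z≤n , <⇒≤ 2+a≤m) , b∈
  S-inside M∣2K _ {a} {b} east ((_ , 1+a≤m) , b∈) s with m≤n⇒m<n∨m≡n 1+a≤m
  ... | inj₁ 2+a≤m = (s≤s z≤n , 2+a≤m) , b∈
  ... | inj₂ refl  =
    contradiction s (not-¬ (S-frame (suc (suc a) , suc b) (frame-right (suc (suc a)) (suc b) M∣2K)))
  S-inside _ _ {a} {zero} north _ s =
    contradiction s (not-¬ (S-frame (suc a , 0) (frame-top (suc a))))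
  S-inside _ _ {b = suc b} north (a∈ , (_ , 2+b≤n)) _ = a∈ , (s≤s z≤n , <⇒≤ 2+b≤n)
  S-inside _ M∣2L {a} {b} south (a∈ , (_ , 1+b≤n)) s with m≤n⇒m<n∨m≡n 1+b≤n
  ... | inj₁ 2+b≤n = a∈ , (s≤s z≤n , 2+b≤n)
  ... | inj₂ refl  =
    contradiction s (not-¬ (S-frame (suc a , suc (suc b)) (frame-bottom (suc a) (suc (suc b)) M∣2L)))

  S-even : ∀ a b → colour (suc a , suc b) ≢ κ → oddCount (λ i → S (neighbour i a b)) ≡ false
  S-even a b white = trans (oddCount-cong on-κ)
    (oddCount-pairs A D
      (cong (onLine ∘ +_) (sym (+-suc a b)))
      (cong (onLine ∘ +_ ∘ suc) (+-suc a (suc b)))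
      (cong onLine (sym (ℤ.[1+m]⊖[1+n]≡m⊖n (suc a) b)))
      (cong onLine (ℤ.[1+m]⊖[1+n]≡m⊖n a (suc b))))
    where
    A D : Dir → Bool
    A i = onLine (antidiagonal (neighbour i a b))
    D i = onLine (diagonal (neighbour i a b))
    on-κ : ∀ i → S (neighbour i a b) ≡ A i xor D i
    on-κ i = cong (_∧ (A i xor D i))
      (dec-true (colour (neighbour i a b) ℙ.≟ κ) (trans (colour-neighbour i a b) (≢⇒⁻¹≡ white)))

  S-start : ∀ {a b} → colour (a , b) ≡ κ → antidiagonal (a , b) ≡ c →
            ¬ M ℤ.∣ + a ℤ.+ + a → ¬ M ℤ.∣ + b ℤ.+ + b → S (a , b) ≡ true
  S-start {a} {b} colour≡κ σ≡c M∤2a M∤2b =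
    cong₂ _∧_ (dec-true (colour (a , b) ℙ.≟ κ) colour≡κ)
              (cong₂ _xor_ (dec-true (_ ≈±? c) (inj₁ (≈-reflexive σ≡c)))
                           (dec-false (_ ≈±? c) off-diagonal))
    where
    δ≡ : diagonal (a , b) ≡ + a ℤ.- + b
    δ≡ = diagonal-ℤ a b
    c≡ : c ≡ + a ℤ.+ + b
    c≡ = trans (sym σ≡c) (antidiagonal-ℤ a b)
    off-diagonal : ¬ diagonal (a , b) ≈± c
    off-diagonal (inj₁ (modM M∣δ-c)) = M∤2b (subst (M ℤ.∣_)
      (trans (cong₂ (λ δ c → - (δ ℤ.- c)) δ≡ c≡) (diff-sum (+ a) (+ b))) (ℤ.∣m⇒∣-m M∣δ-c))
    off-diagonal (inj₂ (modM M∣δ+c)) = M∤2a (subst (M ℤ.∣_)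
      (trans (cong₂ (λ δ c → δ ℤ.- - c) δ≡ c≡) (diff+sum (+ a) (+ b))) M∣δ+c)

double : ∀ k → + (2 * k) ≡ + k ℤ.+ + k
double k = trans (cong (λ t → + (k + t)) (+-identityʳ k)) (ℤ.pos-+ k k)

∣⇔∣-double : ∀ {d k} → d ∣ k ⇔ + (2 * d) ℤ.∣ + k ℤ.+ + k
∣⇔∣-double {d} {k} = mk⇔
  (λ d∣k → subst (+ (2 * d) ℤ.∣_) (double k) (ℤ.∣ᵤ⇒∣ (*-monoʳ-∣ 2 d∣k)))
  (λ 2d∣2k → *-cancelˡ-∣ 2 (ℤ.∣⇒∣ᵤ (subst (+ (2 * d) ℤ.∣_) (sym (double k)) 2d∣2k)))

theorem2p7 : (m n : ℕ) → 1 ≤ m → 1 ≤ n →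
    (a b : ℕ) → InGrid m n (a , b) →
    ¬ (gcd (m + 1) (n + 1) ∣ a) → ¬ (gcd (m + 1) (n + 1) ∣ b) →
    PPos m n (pos [] (a , b))
theorem2p7 m n _ _ a b ab∈G d∤a d∤b =
  S-is-losing ab∈G
    (S-start {a} {b} refl refl (d∤a ∘ Equivalence.from ∣⇔∣-double)
                               (d∤b ∘ Equivalence.from ∣⇔∣-double))
  where
  d : ℕ
  d = gcd (m + 1) (n + 1)
  d∣1+ : ∀ k → d ∣ k + 1 → d ∣ suc k
  d∣1+ k = subst (d ∣_) (+-comm k 1)
  open Lines (+ (2 * d)) (colour (a , b)) (+ (a + b))
  open PairingStrategy m n (colour (a , b)) S S-colour
    (S-inside (Equivalence.to ∣⇔∣-double (d∣1+ m (gcd[m,n]∣m (m + 1) (n + 1))))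
              (Equivalence.to ∣⇔∣-double (d∣1+ n (gcd[m,n]∣n (m + 1) (n + 1)))))
    (λ a b _ → S-even a b)
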